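{- Let $k\ge3$, $n\ge2$ be integers and let $L(Wd(k,n))$ be the line graph of the windmill graph $Wd(k,n)$, with maximum degree $\Delta$. Then $\chi_\Delta(L(Wd(k,n)))=n(k-1)+\binom{k-1}{2}$.
   Context: The windmill graph $Wd(k,n)$ consists of $n$ copies of $K_k$ with one vertex from each copy identified into a common center vertex. All graphs are simple, connected and undirected; $N_G(v)$ is the open neighborhood, $d(v)=|N_G(v)|$, $\Delta$ the maximum degree. For a coloring $c$ and vertex set $S$, $c(S)=\{c(u):u\in S\}$. For integers $k'>0$ and $0<r\le\Delta(G)$ with $r\le k'$, a conditional $(k',r)$-coloring of $G$ is a surjective map $c:V(G)\to\{1,\dots,k'\}$ such that (C1) $c(u)\ne c(v)$ whenever $uv\in E(G)$, and (C2) $|c(N_G(v))|\ge\min\{d(v),r\}$ for every vertex $v$. $\chi_r(G)$ is the smallest $k'$ for which $G$ has a conditional $(k',r)$-coloring. -}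

module Defs where

open import Data.Nat using (ℕ; zero; suc; _+_; _*_; _∸_; _⊔_; _⊓_; _≤_; _<_; _≡ᵇ_; _<ᵇ_; _/_)
open import Data.Bool using (Bool; true; false; _∧_; _∨_; not; if_then_else_)
open import Data.Fin using (Fin; toℕ)
open import Data.List using (List; []; _∷_; [_]; length; map; foldr; allFin; concatMap; lookup)
open import Data.Nat.ListAction using (sum)
open import Data.Product using (_×_; _,_; proj₁; proj₂; ∃)
open import Relation.Binary.PropositionalEquality using (_≡_; _≢_)

-- A finite simple graph on the vertex set Fin order, given by a Boolean
-- adjacency function (the concrete graphs built below are symmetric and
-- irreflexive, i.e. simple undirected graphs).
record Graph : Set where
  constructor mkGraph
  field
    order : ℕ
    adj   : Fin order → Fin order → Bool
open Graph public

count : {m : ℕ} → (Fin m → Bool) → ℕ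
count {m} p = sum (map (λ i → if p i then 1 else 0) (allFin m))

anyFin : {m : ℕ} → (Fin m → Bool) → Bool
anyFin {m} p = foldr _∨_ false (map p (allFin m))

_=ᶠ_ : {m : ℕ} → Fin m → Fin m → Bool
i =ᶠ j = toℕ i ≡ᵇ toℕ j

deg : (G : Graph) → Fin (order G) → ℕ
deg G v = count (adj G v)

maxDeg : Graph → ℕ
maxDeg G = foldr _⊔_ 0 (map (deg G) (allFin (order G)))

-- Windmill graph Wd(k,n): a center vertex (0) together with n blades, each
-- consisting of k-1 further vertices; vertex (suc x) lies in blade
-- ⌊x/(k-1)⌋.  Thus each
-- blade together with the center is a copy of K_k.

blade : ℕ → ℕ → ℕ
blade zero    x = 0
blade (suc m) x = x / suc m

windmillAdj : (k n : ℕ) → Fin (suc (n * (k ∸ 1))) → Fin (suc (n * (k ∸ 1))) → Bool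
windmillAdj k n Fin.zero    Fin.zero    = false
windmillAdj k n Fin.zero    (Fin.suc y) = true
windmillAdj k n (Fin.suc x) Fin.zero    = true
windmillAdj k n (Fin.suc x) (Fin.suc y) =
  not (x =ᶠ y) ∧ (blade (k ∸ 1) (toℕ x) ≡ᵇ blade (k ∸ 1) (toℕ y))

Wd : ℕ → ℕ → Graph
Wd k n = mkGraph (suc (n * (k ∸ 1))) (windmillAdj k n)

-- Line graph: vertices are the edges {u,v} (listed once, as u < v) of G;
-- two distinct edges are adjacent iff they share an endpoint.

edgeList : (G : Graph) → List (Fin (order G) × Fin (order G))
edgeList G = concatMap (λ u → concatMap (λ v →
    if (toℕ u <ᵇ toℕ v) ∧ adj G u v then [ (u , v) ] else []) (allFin (order G)))
  (allFin (order G))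

lineAdj : (G : Graph) → Fin (length (edgeList G)) → Fin (length (edgeList G)) → Bool
lineAdj G e f with lookup (edgeList G) e | lookup (edgeList G) f
... | (a , b) | (c , d) =
  not (e =ᶠ f) ∧ ((a =ᶠ c) ∨ (a =ᶠ d) ∨ (b =ᶠ c) ∨ (b =ᶠ d))

L : Graph → Graph
L G = mkGraph (length (edgeList G)) (lineAdj G)

nbrColours : (G : Graph) {k' : ℕ} → (Fin (order G) → Fin k') → Fin (order G) → ℕ
nbrColours G c v = count (λ j → anyFin (λ u → adj G v u ∧ (c u =ᶠ j)))

record IsConditionalColoring (G : Graph) (k' r : ℕ) (c : Fin (order G) → Fin k') : Set where
  field
    k'-pos     : 0 < k'
    r-pos      : 0 < r
    r≤Δ        : r ≤ maxDeg G
    r≤k'       : r ≤ k'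
    surjective : ∀ (j : Fin k') → ∃ λ v → c v ≡ j
    proper     : ∀ (u v : Fin (order G)) → adj G u v ≡ true → c u ≢ c v
    condition  : ∀ (v : Fin (order G)) → deg G v ⊓ r ≤ nbrColours G c v

HasConditionalColoring : Graph → ℕ → ℕ → Set
HasConditionalColoring G k' r = ∃ λ (c : Fin (order G) → Fin k') → IsConditionalColoring G k' r c

ConditionalChromaticNumber : Graph → ℕ → ℕ → Set
ConditionalChromaticNumber G r m =
  HasConditionalColoring G m r × (∀ k' → k' < m → HasConditionalColoring G k' r → Data.Empty.⊥)
  where import Data.Empty

-- For r = Δ, condition (C2) says deg v ≤ |c(N(v))|, i.e. c is injective on every
-- neighbourhood; together with properness, a conditional (k′, Δ)-colouring is thus a
-- colouring in which any two distinct vertices at distance at most two get different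
-- colours.  In L(Wd(k,n)) the n(k-1) spokes together with the C(k-1,2) edges of one blade
-- are pairwise at distance at most two, so n(k-1) + C(k-1,2) colours are needed.  Giving
-- the spokes distinct colours and colouring every blade with one common palette of
-- C(k-1,2) further colours attains this bound.

module Submission where

open import Defs
open import Data.Bool using (Bool; true; false; T; not; _∧_; _∨_; if_then_else_)
open import Data.Bool.Properties using (T-≡; T-∧; T-∨; ∧-identityʳ; ∧-zeroʳ)
open import Data.Empty using (⊥-elim)
open import Data.Fin using (Fin; toℕ; fromℕ<) renaming (zero to fzero; suc to fsuc)
open import Data.Fin.Properties using (toℕ-injective; toℕ-fromℕ<; toℕ<n; suc-injective; injective⇒≤; _≟_)
open import Data.List using (List; []; _∷_; [_]; map; foldr; allFin; concatMap; lookup)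
open import Data.List.Properties using (map-tabulate)
open import Data.List.Membership.Propositional using (_∈_)
open import Data.List.Membership.Propositional.Properties using (∈-allFin; ∈-lookup; ∈-concatMap⁺; ∈-concatMap⁻)
open import Data.List.Relation.Binary.Disjoint.Propositional using (Disjoint)
import Data.List.Relation.Unary.All as All
import Data.List.Relation.Unary.All.Properties as All
open import Data.List.Relation.Unary.AllPairs using ([]; _∷_)
import Data.List.Relation.Unary.AllPairs as AllPairs
import Data.List.Relation.Unary.AllPairs.Properties as AllPairs
open import Data.List.Relation.Unary.Any using (here; there; satisfied; index)
import Data.List.Relation.Unary.Any as Any
open import Data.List.Relation.Unary.Any.Properties using (any⁺; any⁻; lookup-index)
open import Data.List.Relation.Unary.Unique.Propositional using (Unique)
open import Data.List.Relation.Unary.Unique.Propositional.Properties using (concat⁺; allFin⁺)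
open import Data.Nat using (ℕ; zero; suc; _+_; _*_; _∸_; _⊔_; _≤_; _<_; _<ᵇ_; z≤n; s≤s; z<s; NonZero; _<?_)
open import Data.Nat.Properties hiding (suc-injective; _≟_)
open import Data.Nat.Combinatorics using (_C_; nC1≡n; nCk+nC[k+1]≡[n+1]C[k+1])
open import Data.Nat.DivMod using (_/_; _%_; m≡m%n+[m/n]*n; m<n⇒m/n≡0; m<n⇒m%n≡m; m%n<n)
open import Data.Nat.ListAction using (sum)
open import Data.Product using (_×_; _,_; proj₁; proj₂; ∃; ∃₂)
open import Data.Sum using (_⊎_; inj₁; inj₂)
open import Function using (_∘_; id; Equivalence)
open import Relation.Binary using (tri<; tri≈; tri>)
open import Relation.Binary.PropositionalEquality hiding ([_])
open import Relation.Nullary using (¬_; yes; no)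
open import Relation.Nullary.Decidable using (T?)
open import Algebra.Properties.CommutativeSemigroup +-commutativeSemigroup using (interchange)

open Equivalence using (to; from)

=ᶠ⇒≡ : ∀ {m} {i j : Fin m} → T (i =ᶠ j) → i ≡ j
=ᶠ⇒≡ t = toℕ-injective (≡ᵇ⇒≡ _ _ t)

=ᶠ-refl : ∀ {m} (i : Fin m) → T (i =ᶠ i)
=ᶠ-refl i = ≡⇒≡ᵇ (toℕ i) (toℕ i) refl

≢⇒T-not-=ᶠ : ∀ {m} {i j : Fin m} → i ≢ j → T (not (i =ᶠ j))
≢⇒T-not-=ᶠ {i = i} {j} i≢j with i =ᶠ j in eq
... | true  = ⊥-elim (i≢j (=ᶠ⇒≡ (subst T (sym eq) _)))
... | false = _

T-not⇒¬T : ∀ {b} → T (not b) → ¬ T b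
T-not⇒¬T {false} _ ()

T-∨ˡ : ∀ {x y} → T x → T (x ∨ y)
T-∨ˡ {true} _ = _

T-∨ʳ : ∀ x {y} → T y → T (x ∨ y)
T-∨ʳ false t = t
T-∨ʳ true  _ = _

-- Counting over Fin

indicator : Bool → ℕ
indicator b = if b then 1 else 0

count-suc : ∀ {m} (p : Fin (suc m) → Bool) →
            count p ≡ indicator (p fzero) + count (λ i → p (fsuc i))
count-suc p = cong (λ xs → indicator (p fzero) + sum xs)
  (trans (map-tabulate fsuc (λ i → indicator (p i)))
         (sym (map-tabulate id (λ i → indicator (p (fsuc i))))))

count-cong : ∀ {m} {p q : Fin m → Bool} → (∀ i → p i ≡ q i) → count p ≡ count q
count-cong {zero}          _   = refl
count-cong {suc m} {p} {q} p≗q = begin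
  count p                                ≡⟨ count-suc p ⟩
  indicator (p fzero) + count (p ∘ fsuc) ≡⟨ cong₂ _+_ (cong indicator (p≗q fzero)) (count-cong (p≗q ∘ fsuc)) ⟩
  indicator (q fzero) + count (q ∘ fsuc) ≡⟨ count-suc q ⟨
  count q                                ∎
  where open ≡-Reasoning

count-none : ∀ {m} {p : Fin m → Bool} → (∀ i → ¬ T (p i)) → count p ≡ 0
count-none {zero}      _    = refl
count-none {suc m} {p} none =
  trans (count-suc p) (cong₂ _+_ (indicator-¬T (none fzero)) (count-none (none ∘ fsuc)))
  where
  indicator-¬T : ∀ {b} → ¬ T b → indicator b ≡ 0
  indicator-¬T {false} _  = refl
  indicator-¬T {true}  ¬t = ⊥-elim (¬t _)

count-mono : ∀ {m} {p q : Fin m → Bool} → (∀ i → T (p i) → T (q i)) → count p ≤ count q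
count-mono {zero}          _   = z≤n
count-mono {suc m} {p} {q} p⊆q = begin
  count p                                ≡⟨ count-suc p ⟩
  indicator (p fzero) + count (p ∘ fsuc) ≤⟨ +-mono-≤ (indicator-mono (p⊆q fzero)) (count-mono (p⊆q ∘ fsuc)) ⟩
  indicator (q fzero) + count (q ∘ fsuc) ≡⟨ count-suc q ⟨
  count q                                ∎
  where
  open ≤-Reasoning
  indicator-mono : ∀ {a b} → (T a → T b) → indicator a ≤ indicator b
  indicator-mono {false}         _ = z≤n
  indicator-mono {true} {true}   _ = ≤-refl
  indicator-mono {true} {false} a⇒b = ⊥-elim (a⇒b _)

count≤size : ∀ {m} (p : Fin m → Bool) → count p ≤ m
count≤size {zero}  p = z≤n
count≤size {suc m} p = begin
  count p                                ≡⟨ count-suc p ⟩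
  indicator (p fzero) + count (p ∘ fsuc) ≤⟨ +-mono-≤ (indicator≤1 (p fzero)) (count≤size _) ⟩
  suc m                                  ∎
  where
  open ≤-Reasoning
  indicator≤1 : ∀ b → indicator b ≤ 1
  indicator≤1 false = z≤n
  indicator≤1 true  = ≤-refl

count-∨+count-∧ : ∀ {m} (p q : Fin m → Bool) →
                  count (λ i → p i ∨ q i) + count (λ i → p i ∧ q i) ≡ count p + count q
count-∨+count-∧ {zero}  p q = refl
count-∨+count-∧ {suc m} p q = begin
  count p∨q + count p∧q
    ≡⟨ cong₂ _+_ (count-suc p∨q) (count-suc p∧q) ⟩
  (indicator (p∨q fzero) + count (p∨q ∘ fsuc)) + (indicator (p∧q fzero) + count (p∧q ∘ fsuc))
    ≡⟨ interchange (indicator (p∨q fzero)) _ _ _ ⟩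
  (indicator (p∨q fzero) + indicator (p∧q fzero)) + (count (p∨q ∘ fsuc) + count (p∧q ∘ fsuc))
    ≡⟨ cong₂ _+_ (indicator-∨+∧ (p fzero) (q fzero)) (count-∨+count-∧ (p ∘ fsuc) (q ∘ fsuc)) ⟩
  (indicator (p fzero) + indicator (q fzero)) + (count (p ∘ fsuc) + count (q ∘ fsuc))
    ≡⟨ interchange (indicator (p fzero)) _ _ _ ⟩
  (indicator (p fzero) + count (p ∘ fsuc)) + (indicator (q fzero) + count (q ∘ fsuc))
    ≡⟨ cong₂ _+_ (count-suc p) (count-suc q) ⟨
  count p + count q ∎
  where
  open ≡-Reasoning
  p∨q p∧q : Fin (suc m) → Bool
  p∨q i = p i ∨ q i
  p∧q i = p i ∧ q i
  indicator-∨+∧ : ∀ a b → indicator (a ∨ b) + indicator (a ∧ b) ≡ indicator a + indicator b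
  indicator-∨+∧ false b     = +-identityʳ (indicator b)
  indicator-∨+∧ true  false = refl
  indicator-∨+∧ true  true  = refl

count-remove : ∀ {m} (p : Fin m → Bool) {v : Fin m} → T (p v) →
               count p ≡ suc (count (λ w → p w ∧ not (w =ᶠ v)))
count-remove {suc m} p {fzero} pv = begin
  count p
    ≡⟨ count-suc p ⟩
  indicator (p fzero) + count (p ∘ fsuc)
    ≡⟨ cong₂ _+_ (indicator-T pv) (count-cong (sym ∘ ∧-identityʳ ∘ p ∘ fsuc)) ⟩
  suc (indicator false + count (p′ ∘ fsuc))
    ≡⟨ cong (λ b → suc (indicator b + count (p′ ∘ fsuc))) (∧-zeroʳ (p fzero)) ⟨
  suc (indicator (p′ fzero) + count (p′ ∘ fsuc))
    ≡⟨ cong suc (count-suc p′) ⟨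
  suc (count p′)
    ∎
  where
  open ≡-Reasoning
  p′ : Fin (suc m) → Bool
  p′ w = p w ∧ not (w =ᶠ fzero)
  indicator-T : ∀ {b} → T b → indicator b ≡ 1
  indicator-T {true} _ = refl
count-remove {suc m} p {fsuc v} pv = begin
  count p
    ≡⟨ count-suc p ⟩
  indicator (p fzero) + count (p ∘ fsuc)
    ≡⟨ cong₂ _+_ (cong indicator (sym (∧-identityʳ (p fzero)))) (count-remove (p ∘ fsuc) pv) ⟩
  indicator (p′ fzero) + suc (count (p′ ∘ fsuc))
    ≡⟨ +-suc _ _ ⟩
  suc (indicator (p′ fzero) + count (p′ ∘ fsuc))
    ≡⟨ cong suc (count-suc p′) ⟨
  suc (count p′)
    ∎
  where
  open ≡-Reasoning
  p′ : Fin (suc m) → Bool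
  p′ w = p w ∧ not (w =ᶠ fsuc v)

count-single : ∀ {m} (i : Fin m) → count (i =ᶠ_) ≡ 1
count-single {suc m} fzero    =
  trans (count-suc {m} (fzero =ᶠ_)) (cong suc (count-none {m} {λ j → fzero =ᶠ fsuc j} (λ _ ())))
count-single {suc m} (fsuc i) = trans (count-suc (fsuc i =ᶠ_)) (count-single i)

anyFin-suc : ∀ {m} (p : Fin (suc m) → Bool) → anyFin p ≡ (p fzero ∨ anyFin (λ i → p (fsuc i)))
anyFin-suc p = cong (λ bs → p fzero ∨ foldr _∨_ false bs)
  (trans (map-tabulate fsuc p) (sym (map-tabulate id (λ i → p (fsuc i)))))

anyFin⁺ : ∀ {m} (p : Fin m → Bool) {i : Fin m} → T (p i) → T (anyFin p)
anyFin⁺ p t = any⁺ p (Any.map (λ { refl → t }) (∈-allFin _))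

anyFin⁻ : ∀ {m} (p : Fin m → Bool) → T (anyFin p) → ∃ λ i → T (p i)
anyFin⁻ {m} p t = satisfied (any⁻ p (allFin m) t)

image : ∀ {N m} → (Fin N → Bool) → (Fin N → Fin m) → Fin m → Bool
image P f j = anyFin (λ u → P u ∧ (f u =ᶠ j))

image⁺ : ∀ {N m} (P : Fin N → Bool) (f : Fin N → Fin m) {u j} →
         T (P u) → f u ≡ j → T (image P f j)
image⁺ P f {u} pu refl = anyFin⁺ (λ w → P w ∧ (f w =ᶠ f u)) (from T-∧ (pu , =ᶠ-refl (f u)))

image⁻ : ∀ {N m} (P : Fin N → Bool) (f : Fin N → Fin m) {j} →
         T (image P f j) → ∃ λ u → T (P u) × f u ≡ j
image⁻ P f t with anyFin⁻ _ t
... | u , t′ with to T-∧ t′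
...   | pu , fu=j = u , pu , =ᶠ⇒≡ fu=j

InjectiveOn : ∀ {N m} → (Fin N → Bool) → (Fin N → Fin m) → Set
InjectiveOn P f = ∀ {u v} → T (P u) → T (P v) → f u ≡ f v → u ≡ v

count-image-suc : ∀ {N m} (P : Fin (suc N) → Bool) (f : Fin (suc N) → Fin m) →
  count (image P f) + count (λ j → (P fzero ∧ (f fzero =ᶠ j)) ∧ image (P ∘ fsuc) (f ∘ fsuc) j) ≡
  indicator (P fzero) + count (image (P ∘ fsuc) (f ∘ fsuc))
count-image-suc {N} {m} P f = begin
  count (image P f) + count (λ j → hd j ∧ tl j)
    ≡⟨ cong (_+ count (λ j → hd j ∧ tl j)) (count-cong (anyFin-suc ∘ image-clause)) ⟩
  count (λ j → hd j ∨ tl j) + count (λ j → hd j ∧ tl j) ≡⟨ count-∨+count-∧ hd tl ⟩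
  count hd + count tl                                   ≡⟨ cong (_+ count tl) count-hd ⟩
  indicator (P fzero) + count tl                        ∎
  where
  open ≡-Reasoning
  image-clause : Fin m → Fin (suc N) → Bool
  image-clause j u = P u ∧ (f u =ᶠ j)
  hd tl : Fin m → Bool
  hd j = P fzero ∧ (f fzero =ᶠ j)
  tl = image (P ∘ fsuc) (f ∘ fsuc)
  count-hd : count hd ≡ indicator (P fzero)
  count-hd with P fzero
  ... | true  = count-single (f fzero)
  ... | false = count-none {p = λ (_ : Fin m) → false} (λ _ ())

count-image≤ : ∀ {N m} (P : Fin N → Bool) (f : Fin N → Fin m) → count (image P f) ≤ count P
count-image≤ {zero}  P f = ≤-reflexive (count-none {p = image P f} (λ _ ()))
count-image≤ {suc N} P f = begin
  count (image P f)                                         ≤⟨ m≤m+n _ _ ⟩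
  count (image P f) + _                                     ≡⟨ count-image-suc P f ⟩
  indicator (P fzero) + count (image (P ∘ fsuc) (f ∘ fsuc)) ≤⟨ +-monoʳ-≤ _ (count-image≤ (P ∘ fsuc) (f ∘ fsuc)) ⟩
  indicator (P fzero) + count (P ∘ fsuc)                    ≡⟨ count-suc P ⟨
  count P                                                   ∎
  where open ≤-Reasoning

count-image-injective : ∀ {N m} (P : Fin N → Bool) (f : Fin N → Fin m) →
                        InjectiveOn P f → count P ≤ count (image P f)
count-image-injective {zero}  P f _   = z≤n
count-image-injective {suc N} P f inj = begin
  count P                                                   ≡⟨ count-suc P ⟩
  indicator (P fzero) + count (P ∘ fsuc)
    ≤⟨ +-monoʳ-≤ _ (count-image-injective (P ∘ fsuc) (f ∘ fsuc) (λ pu pv → suc-injective ∘ inj pu pv)) ⟩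
  indicator (P fzero) + count (image (P ∘ fsuc) (f ∘ fsuc)) ≡⟨ count-image-suc P f ⟨
  count (image P f) + _                                     ≡⟨ cong (count (image P f) +_) (count-none disjoint) ⟩
  count (image P f) + 0                                     ≡⟨ +-identityʳ _ ⟩
  count (image P f)                                         ∎
  where
  open ≤-Reasoning
  disjoint : ∀ j → ¬ T ((P fzero ∧ (f fzero =ᶠ j)) ∧ image (P ∘ fsuc) (f ∘ fsuc) j)
  disjoint j t with to T-∧ t
  ... | hd , tl with to T-∧ hd | image⁻ (P ∘ fsuc) (f ∘ fsuc) tl
  ...   | p0 , f0=j | u , pu , fu≡j with inj p0 pu (trans (=ᶠ⇒≡ f0=j) (sym fu≡j))
  ...     | ()

count-image-< : ∀ {N m} (P : Fin N → Bool) (f : Fin N → Fin m) {u v} → u ≢ v →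
                T (P u) → T (P v) → f u ≡ f v → count (image P f) < count P
count-image-< P f {u} {v} u≢v pu pv fu≡fv = begin-strict
  count (image P f)  ≤⟨ count-mono image⊆image′ ⟩
  count (image P′ f) ≤⟨ count-image≤ P′ f ⟩
  count P′           <⟨ n<1+n _ ⟩
  suc (count P′)     ≡⟨ count-remove P pv ⟨
  count P            ∎
  where
  open ≤-Reasoning
  P′ : _ → Bool
  P′ w = P w ∧ not (w =ᶠ v)
  P′-intro : ∀ {w} → T (P w) → w ≢ v → T (P′ w)
  P′-intro pw w≢v = from T-∧ (pw , ≢⇒T-not-=ᶠ w≢v)
  image⊆image′ : ∀ j → T (image P f j) → T (image P′ f j)
  image⊆image′ j t with image⁻ P f t
  ... | w , pw , fw≡j with w ≟ v
  ...   | yes refl = image⁺ P′ f (P′-intro pu u≢v) (trans fu≡fv fw≡j)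
  ...   | no  w≢v  = image⁺ P′ f (P′-intro pw w≢v) fw≡j

-- Conditional colourings with r = Δ

module _ {A : Set} (g : A → ℕ) where

  ≤-maximum : ∀ {x xs} → x ∈ xs → g x ≤ foldr _⊔_ 0 (map g xs)
  ≤-maximum {xs = y ∷ _} (here refl) = m≤m⊔n (g y) _
  ≤-maximum {xs = y ∷ _} (there x∈xs) = ≤-trans (≤-maximum x∈xs) (m≤n⊔m (g y) _)

  maximum≤ : ∀ {b} xs → (∀ x → g x ≤ b) → foldr _⊔_ 0 (map g xs) ≤ b
  maximum≤ []       _   = z≤n
  maximum≤ (x ∷ xs) g≤b = ⊔-lub (g≤b x) (maximum≤ xs g≤b)

deg≤maxDeg : ∀ G v → deg G v ≤ maxDeg G
deg≤maxDeg G v = ≤-maximum (deg G) (∈-allFin v)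

maxDeg≤ : ∀ G {b} → (∀ v → deg G v ≤ b) → maxDeg G ≤ b
maxDeg≤ G = maximum≤ (deg G) (allFin (order G))

0<maxDeg : ∀ G {u v} → T (adj G u v) → 0 < maxDeg G
0<maxDeg G {u} uv =
  <-≤-trans (subst (0 <_) (sym (count-remove (adj G u) uv)) z<s) (deg≤maxDeg G u)

Near : (G : Graph) → Fin (order G) → Fin (order G) → Set
Near G u v = T (adj G u v) ⊎ ∃ λ w → T (adj G w u) × T (adj G w v)

module _ {G : Graph} {k′ : ℕ} {c : Fin (order G) → Fin k′}
         (c-cond : IsConditionalColoring G k′ (maxDeg G) c) where

  open IsConditionalColoring c-cond

  -- At a common neighbour w, (C2) with r = Δ ≥ deg w rules out a repeated colour on N(w).
  near⇒colours-differ : ∀ {u v} → u ≢ v → Near G u v → c u ≢ c v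
  near⇒colours-differ _   (inj₁ uv)            = proper _ _ (to T-≡ uv)
  near⇒colours-differ u≢v (inj₂ (w , wu , wv)) cu≡cv =
    <⇒≱ (count-image-< (adj G w) c u≢v wu wv cu≡cv)
        (subst (_≤ nbrColours G c w) (m≤n⇒m⊓n≡m (deg≤maxDeg G w)) (condition w))

  nearClique≤colours : ∀ {m} (s : Fin m → Fin (order G)) → (∀ {i j} → s i ≡ s j → i ≡ j) →
    (∀ i j → s i ≢ s j → Near G (s i) (s j)) → m ≤ k′
  nearClique≤colours s s-injective s-near = injective⇒≤ c∘s-injective
    where
    c∘s-injective : ∀ {i j} → c (s i) ≡ c (s j) → i ≡ j
    c∘s-injective {i} {j} eq with s i ≟ s j
    ... | yes si≡sj = s-injective si≡sj
    ... | no  si≢sj = ⊥-elim (near⇒colours-differ si≢sj (s-near i j si≢sj) eq)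

module _ (G : Graph) {m : ℕ} (c : Fin (order G) → Fin m) where

  IsProper LocallyInjective : Set
  IsProper         = ∀ u v → T (adj G u v) → c u ≢ c v
  LocallyInjective = ∀ w → InjectiveOn (adj G w) c

  isConditionalColoring-maxDeg : 0 < m → 0 < maxDeg G → (∀ j → ∃ λ v → c v ≡ j) →
    IsProper → LocallyInjective → IsConditionalColoring G m (maxDeg G) c
  isConditionalColoring-maxDeg 0<m 0<Δ surj c-proper c-inj = record
    { k'-pos     = 0<m
    ; r-pos      = 0<Δ
    ; r≤Δ        = ≤-refl
    ; r≤k'       = maxDeg≤ G (λ v → ≤-trans (deg≤nbrColours v) (count≤size _))
    ; surjective = surj
    ; proper     = λ u v uv → c-proper u v (from T-≡ uv)
    ; condition  = λ v → ≤-trans (m⊓n≤m _ _) (deg≤nbrColours v)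
    }
    where
    deg≤nbrColours : ∀ v → deg G v ≤ nbrColours G c v
    deg≤nbrColours v = count-image-injective (adj G v) c (c-inj v)

  conditionalChromaticNumber-maxDeg : (s : Fin m → Fin (order G)) → (∀ j → c (s j) ≡ j) →
    IsProper → LocallyInjective → (∀ i j → s i ≢ s j → Near G (s i) (s j)) → 1 < m →
    ConditionalChromaticNumber G (maxDeg G) m
  conditionalChromaticNumber-maxDeg s c∘s≗id c-proper c-inj s-near 1<m =
    (c , isConditionalColoring-maxDeg 0<m 0<Δ (λ j → s j , c∘s≗id j) c-proper c-inj) ,
    λ k′ k′<m (c′ , c′-cond) → <⇒≱ k′<m (nearClique≤colours c′-cond s s-injective s-near)
    where
    s-injective : ∀ {i j} → s i ≡ s j → i ≡ j
    s-injective {i} {j} eq = trans (sym (c∘s≗id i)) (trans (cong c eq) (c∘s≗id j))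
    0<m : 0 < m
    0<m = <-trans z<s 1<m
    0≢1 : fromℕ< 0<m ≢ fromℕ< 1<m
    0≢1 eq with trans (sym (toℕ-fromℕ< 0<m)) (trans (cong toℕ eq) (toℕ-fromℕ< 1<m))
    ... | ()
    0<Δ : 0 < maxDeg G
    0<Δ with s-near _ _ (0≢1 ∘ s-injective)
    ... | inj₁ uv           = 0<maxDeg G uv
    ... | inj₂ (_ , wu , _) = 0<maxDeg G wu

-- Line graphs

lookup-injective : ∀ {A : Set} {xs : List A} → Unique xs →
                   ∀ {i j} → lookup xs i ≡ lookup xs j → i ≡ j
lookup-injective (_  ∷ _) {fzero}  {fzero}  _  = refl
lookup-injective (x∉ ∷ _) {fzero}  {fsuc j} eq = ⊥-elim (All.lookup x∉ (∈-lookup j) eq)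
lookup-injective (x∉ ∷ _) {fsuc i} {fzero}  eq = ⊥-elim (All.lookup x∉ (∈-lookup i) (sym eq))
lookup-injective (_  ∷ u) {fsuc i} {fsuc j} eq = cong fsuc (lookup-injective u eq)

concatMap-unique : ∀ {A B : Set} (f : A → List B) (key : B → A) →
  (∀ {x y} → y ∈ f x → key y ≡ x) → (∀ x → Unique (f x)) →
  ∀ {xs} → Unique xs → Unique (concatMap f xs)
concatMap-unique f key key-f f-unique xs-unique =
  concat⁺ (All.map⁺ (All.universal f-unique _)) (AllPairs.map⁺ (AllPairs.map disjoint xs-unique))
  where
  disjoint : ∀ {x y} → x ≢ y → Disjoint (f x) (f y)
  disjoint x≢y (p , q) = x≢y (trans (sym (key-f p)) (key-f q))

∈-if⁻ : ∀ {A : Set} {b} {x y : A} → y ∈ (if b then [ x ] else []) → y ≡ x × T b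
∈-if⁻ {b = true} (here refl) = refl , _

∈-if⁺ : ∀ {A : Set} {b} {x : A} → T b → x ∈ (if b then [ x ] else [])
∈-if⁺ {b = true} _ = here refl

if-unique : ∀ {A : Set} b {x : A} → Unique (if b then [ x ] else [])
if-unique true  = All.[] ∷ []
if-unique false = []

module _ (G : Graph) where

  private
    V = Fin (order G)

  isEdge : V × V → Bool
  isEdge e = (toℕ (proj₁ e) <ᵇ toℕ (proj₂ e)) ∧ adj G (proj₁ e) (proj₂ e)

  private
    cell : V → V → List (V × V)
    cell u v = if isEdge (u , v) then [ (u , v) ] else []

    row : V → List (V × V)
    row u = concatMap (cell u) (allFin (order G))

    row-key : ∀ {u e} → e ∈ row u → proj₁ e ≡ u
    row-key {u} e∈row with satisfied (∈-concatMap⁻ (cell u) {xs = allFin (order G)} e∈row)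
    ... | _ , e∈cell = cong proj₁ (proj₁ (∈-if⁻ e∈cell))

  ∈-edgeList⁻ : ∀ {e} → e ∈ edgeList G → T (isEdge e)
  ∈-edgeList⁻ e∈ with satisfied (∈-concatMap⁻ row {xs = allFin (order G)} e∈)
  ... | u , e∈row with satisfied (∈-concatMap⁻ (cell u) {xs = allFin (order G)} e∈row)
  ...   | _ , e∈cell with ∈-if⁻ e∈cell
  ...     | refl , t = t

  ∈-edgeList⁺ : ∀ {e} → T (isEdge e) → e ∈ edgeList G
  ∈-edgeList⁺ {u , v} t = ∈-concatMap⁺ row {xs = allFin (order G)}
    (Any.map (λ { refl → ∈-concatMap⁺ (cell u) {xs = allFin (order G)}
                           (Any.map (λ { refl → ∈-if⁺ t }) (∈-allFin v)) })
             (∈-allFin u))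

  edgeList-unique : Unique (edgeList G)
  edgeList-unique = concatMap-unique row proj₁ row-key
    (λ u → concatMap-unique (cell u) proj₂ (λ e∈cell → cong proj₂ (proj₁ (∈-if⁻ e∈cell)))
                            (λ v → if-unique (isEdge (u , v))) (allFin⁺ (order G)))
    (allFin⁺ (order G))

  edgeAt : Fin (order (L G)) → V × V
  edgeAt = lookup (edgeList G)

  edgeAt-isEdge : ∀ e → T (isEdge (edgeAt e))
  edgeAt-isEdge e = ∈-edgeList⁻ (∈-lookup e)

  edgeAt-injective : ∀ {e f} → edgeAt e ≡ edgeAt f → e ≡ f
  edgeAt-injective = lookup-injective edgeList-unique

  edgeIndex : ∀ {e} → T (isEdge e) → ∃ λ i → edgeAt i ≡ e
  edgeIndex t = index e∈ , sym (lookup-index e∈)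
    where e∈ = ∈-edgeList⁺ t

_∈ₑ_ : ∀ {A : Set} → A → A × A → Set
w ∈ₑ e = w ≡ proj₁ e ⊎ w ≡ proj₂ e

Meet : ∀ {A : Set} → A × A → A × A → Set
Meet e f = ∃ λ w → w ∈ₑ e × w ∈ₑ f

Meet-refl : ∀ {A : Set} (e : A × A) → Meet e e
Meet-refl e = proj₁ e , inj₁ refl , inj₁ refl

Meet-sym : ∀ {A : Set} {e f : A × A} → Meet e f → Meet f e
Meet-sym (w , w∈e , w∈f) = w , w∈f , w∈e

module _ {m : ℕ} {a b c d : Fin m} where

  T-shared⇒Meet : T ((a =ᶠ c) ∨ (a =ᶠ d) ∨ (b =ᶠ c) ∨ (b =ᶠ d)) → Meet (a , b) (c , d)
  T-shared⇒Meet t with to T-∨ t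
  ... | inj₁ a=c = a , inj₁ refl , inj₁ (=ᶠ⇒≡ a=c)
  ... | inj₂ t′ with to T-∨ t′
  ...   | inj₁ a=d = a , inj₁ refl , inj₂ (=ᶠ⇒≡ a=d)
  ...   | inj₂ t″ with to T-∨ t″
  ...     | inj₁ b=c = b , inj₂ refl , inj₁ (=ᶠ⇒≡ b=c)
  ...     | inj₂ b=d = b , inj₂ refl , inj₂ (=ᶠ⇒≡ b=d)

  Meet⇒T-shared : Meet (a , b) (c , d) → T ((a =ᶠ c) ∨ (a =ᶠ d) ∨ (b =ᶠ c) ∨ (b =ᶠ d))
  Meet⇒T-shared (w , inj₁ refl , inj₁ refl) = T-∨ˡ (=ᶠ-refl w)
  Meet⇒T-shared (w , inj₁ refl , inj₂ refl) = T-∨ʳ (w =ᶠ c) (T-∨ˡ (=ᶠ-refl w))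
  Meet⇒T-shared (w , inj₂ refl , inj₁ refl) = T-∨ʳ (a =ᶠ w) (T-∨ʳ (a =ᶠ d) (T-∨ˡ (=ᶠ-refl w)))
  Meet⇒T-shared (w , inj₂ refl , inj₂ refl) =
    T-∨ʳ (a =ᶠ c) (T-∨ʳ (a =ᶠ w) (T-∨ʳ (w =ᶠ c) (=ᶠ-refl w)))

module _ (G : Graph) where

  L-adj⁻ : ∀ {e f} → T (adj (L G) e f) → e ≢ f × Meet (edgeAt G e) (edgeAt G f)
  L-adj⁻ {e} {f} t with lookup (edgeList G) e | lookup (edgeList G) f
  ... | a , b | c , d with to T-∧ t
  ...   | e≠f , shared = (λ { refl → T-not⇒¬T e≠f (=ᶠ-refl e) }) , T-shared⇒Meet shared

  L-adj⁺ : ∀ {e f} → e ≢ f → Meet (edgeAt G e) (edgeAt G f) → T (adj (L G) e f)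
  L-adj⁺ {e} {f} e≢f meet with lookup (edgeList G) e | lookup (edgeList G) f
  ... | a , b | c , d = from T-∧ (≢⇒T-not-=ᶠ e≢f , Meet⇒T-shared meet)

  meetingEdge⇒Near : ∀ {e f g} → e ≢ f → T (isEdge G g) →
    Meet g (edgeAt G e) → Meet g (edgeAt G f) → Near (L G) e f
  meetingEdge⇒Near {e} {f} e≢f g-edge g∼e g∼f with T? (adj (L G) e f) | edgeIndex G g-edge
  ... | yes e∼f | _       = inj₁ e∼f
  ... | no  e≁f | w , w↦g = inj₂ (w , L-adj⁺ w≢e w∼e , L-adj⁺ w≢f w∼f)
    where
    w∼e : Meet (edgeAt G w) (edgeAt G e)
    w∼e = subst (λ h → Meet h _) (sym w↦g) g∼e
    w∼f : Meet (edgeAt G w) (edgeAt G f)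
    w∼f = subst (λ h → Meet h _) (sym w↦g) g∼f
    w≢e : w ≢ e
    w≢e refl = e≁f (L-adj⁺ e≢f w∼f)
    w≢f : w ≢ f
    w≢f refl = e≁f (L-adj⁺ e≢f (Meet-sym w∼e))

-- Arithmetic

triangular : ℕ → ℕ
triangular zero    = 0
triangular (suc b) = b + triangular b

triangular≡C2 : ∀ b → triangular b ≡ b C 2
triangular≡C2 zero    = refl
triangular≡C2 (suc b) =
  trans (cong₂ _+_ (sym (nC1≡n b)) (triangular≡C2 b)) (nCk+nC[k+1]≡[n+1]C[k+1] b 1)

triangular-mono-≤ : ∀ {a b} → a ≤ b → triangular a ≤ triangular b
triangular-mono-≤ {zero}              _         = z≤n
triangular-mono-≤ {suc a} {suc b} (s≤s a≤b) = +-mono-≤ a≤b (triangular-mono-≤ a≤b)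

-- Enumerates the pairs a < b colexicographically.
pairIndex : ℕ → ℕ → ℕ
pairIndex a b = triangular b + a

pairIndex<triangular : ∀ {a b c} → a < b → b < c → pairIndex a b < triangular c
pairIndex<triangular {a} {b} {c} a<b b<c = begin-strict
  triangular b + a   <⟨ +-monoʳ-< (triangular b) a<b ⟩
  triangular b + b   ≡⟨ +-comm (triangular b) b ⟩
  triangular (suc b) ≤⟨ triangular-mono-≤ b<c ⟩
  triangular c       ∎
  where open ≤-Reasoning

pairIndex-injective : ∀ {a b a′ b′} → a < b → a′ < b′ →
                      pairIndex a b ≡ pairIndex a′ b′ → a ≡ a′ × b ≡ b′
pairIndex-injective {a} {b} {a′} {b′} a<b a′<b′ eq with <-cmp b b′
... | tri< b<b′ _ _ = ⊥-elim (<-irrefl eq (<-≤-trans (pairIndex<triangular a<b b<b′) (m≤m+n _ a′)))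
... | tri> _ _ b′<b = ⊥-elim (<-irrefl (sym eq) (<-≤-trans (pairIndex<triangular a′<b′ b′<b) (m≤m+n _ a)))
... | tri≈ _ refl _ = +-cancelˡ-≡ (triangular b) a a′ eq , refl

pairIndex-surjective : ∀ c {t} → t < triangular c → ∃₂ λ a b → a < b × b < c × pairIndex a b ≡ t
pairIndex-surjective (suc c) {t} t<tri with t <? triangular c
... | yes t<tri′ with pairIndex-surjective c t<tri′
...   | a , b , a<b , b<c , eq = a , b , a<b , m<n⇒m<1+n b<c , eq
pairIndex-surjective (suc c) {t} t<tri | no t≮tri′ =
  t ∸ triangular c , c , t∸tri<c , n<1+n c , m+[n∸m]≡n tri≤t
  where
  tri≤t = ≮⇒≥ t≮tri′
  t∸tri<c : t ∸ triangular c < c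
  t∸tri<c = +-cancelˡ-< (triangular c) _ _
    (subst₂ _<_ (sym (m+[n∸m]≡n tri≤t)) (+-comm c (triangular c)) t<tri)

module _ (d : ℕ) .{{_ : NonZero d}} where

  /-%-injective : ∀ {x y} → x / d ≡ y / d → x % d ≡ y % d → x ≡ y
  /-%-injective {x} {y} /≡ %≡ = begin
    x                     ≡⟨ m≡m%n+[m/n]*n x d ⟩
    x % d + (x / d) * d   ≡⟨ cong₂ (λ r q → r + q * d) %≡ /≡ ⟩
    y % d + (y / d) * d   ≡⟨ m≡m%n+[m/n]*n y d ⟨
    y                     ∎
    where open ≡-Reasoning

  %-mono-<-on-/ : ∀ {x y} → x < y → x / d ≡ y / d → x % d < y % d
  %-mono-<-on-/ {x} {y} x<y /≡ = +-cancelʳ-< ((x / d) * d) (x % d) (y % d) (begin-strict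
    x % d + (x / d) * d   ≡⟨ m≡m%n+[m/n]*n x d ⟨
    x                     <⟨ x<y ⟩
    y                     ≡⟨ m≡m%n+[m/n]*n y d ⟩
    y % d + (y / d) * d   ≡⟨ cong (λ q → y % d + q * d) /≡ ⟨
    y % d + (x / d) * d   ∎)
    where open ≤-Reasoning

-- The line graph of a windmill

-- K = k - 1 is the number of non-centre vertices of a blade; here k ≥ 3 and n ≥ 1.
module Windmill (k₀ n₀ : ℕ) where

  K n N m : ℕ
  K = suc (suc k₀)
  n = suc n₀
  N = n * K
  m = N + triangular K

  W : Graph
  W = Wd (suc K) n

  V : Set
  V = Fin (suc N)

  bladeOf : Fin N → ℕ
  bladeOf x = blade K (toℕ x)

  data WdEdge : V × V → Set where
    spoke   : (y : Fin N) → WdEdge (fzero , fsuc y)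
    inBlade : ∀ {x y} → toℕ x < toℕ y → bladeOf x ≡ bladeOf y → WdEdge (fsuc x , fsuc y)

  isEdge⇒WdEdge : ∀ {e} → T (isEdge W e) → WdEdge e
  isEdge⇒WdEdge {fzero  , fsuc y} _ = spoke y
  isEdge⇒WdEdge {fsuc x , fsuc y} t with to T-∧ t
  ... | x<y , t′ = inBlade (<ᵇ⇒< _ _ x<y) (≡ᵇ⇒≡ _ _ (proj₂ (to T-∧ t′)))

  WdEdge⇒isEdge : ∀ {e} → WdEdge e → T (isEdge W e)
  WdEdge⇒isEdge (spoke y)                        = _
  WdEdge⇒isEdge (inBlade {x} {y} x<y same-blade) =
    from T-∧ (<⇒<ᵇ x<y , from T-∧ (≢⇒T-not-=ᶠ {i = x} {y} x≢y , ≡⇒≡ᵇ _ _ same-blade))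
    where x≢y = λ { refl → <-irrefl refl x<y }

  -- Only consulted at non-centre vertices; the value at the centre is arbitrary.
  vertexBlade : V → ℕ
  vertexBlade fzero    = 0
  vertexBlade (fsuc x) = bladeOf x

  Coherent : V × V → V × V → Set
  Coherent e f = proj₁ e ≡ fzero ⊎ proj₁ f ≡ fzero ⊎ vertexBlade (proj₂ e) ≡ vertexBlade (proj₂ f)

  endpoint-blade : ∀ {e z} → WdEdge e → fsuc z ∈ₑ e → bladeOf z ≡ vertexBlade (proj₂ e)
  endpoint-blade (spoke _)              (inj₂ refl) = refl
  endpoint-blade (inBlade _ same-blade) (inj₁ refl) = same-blade
  endpoint-blade (inBlade _ _)          (inj₂ refl) = refl

  meet-inBlade : ∀ {g x y} → WdEdge g → Meet g (fsuc x , fsuc y) → bladeOf x ≡ bladeOf y →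
                 vertexBlade (proj₂ g) ≡ bladeOf y
  meet-inBlade g (_ , w∈g , inj₁ refl) same-blade = trans (sym (endpoint-blade g w∈g)) same-blade
  meet-inBlade g (_ , w∈g , inj₂ refl) _          = sym (endpoint-blade g w∈g)

  meetingEdge⇒Coherent : ∀ {g e f} → WdEdge g → WdEdge e → WdEdge f →
                         Meet g e → Meet g f → Coherent e f
  meetingEdge⇒Coherent _ (spoke _)     _             _   _   = inj₁ refl
  meetingEdge⇒Coherent _ (inBlade _ _) (spoke _)     _   _   = inj₂ (inj₁ refl)
  meetingEdge⇒Coherent g (inBlade _ e-blade) (inBlade _ f-blade) g∼e g∼f =
    inj₂ (inj₂ (trans (sym (meet-inBlade g g∼e e-blade)) (meet-inBlade g g∼f f-blade)))

  -- Spokes get the colours below N; all blades share one palette of C(K,2) colours above N.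
  colour : V × V → ℕ
  colour (fzero  , fsuc y) = toℕ y
  colour (fsuc x , fsuc y) = N + pairIndex (toℕ x % K) (toℕ y % K)
  colour _                 = 0

  colour<m : ∀ {e} → WdEdge e → colour e < m
  colour<m (spoke y)              = <-≤-trans (toℕ<n y) (m≤m+n N _)
  colour<m (inBlade {y = y} x<y same-blade) =
    +-monoʳ-< N (pairIndex<triangular (%-mono-<-on-/ K x<y same-blade) (m%n<n (toℕ y) K))

  colour-injective : ∀ {e f} → WdEdge e → WdEdge f → Coherent e f → colour e ≡ colour f → e ≡ f
  colour-injective (spoke y) (spoke y′) _ eq = cong (λ z → fzero , fsuc z) (toℕ-injective eq)
  colour-injective (spoke y) (inBlade _ _) _ eq =
    ⊥-elim (<-irrefl eq (<-≤-trans (toℕ<n y) (m≤m+n N _)))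
  colour-injective (inBlade _ _) (spoke y′) _ eq =
    ⊥-elim (<-irrefl (sym eq) (<-≤-trans (toℕ<n y′) (m≤m+n N _)))
  colour-injective (inBlade x<y x-blade) (inBlade x′<y′ x′-blade) (inj₂ (inj₂ y-blade)) eq
    with pairIndex-injective (%-mono-<-on-/ K x<y x-blade) (%-mono-<-on-/ K x′<y′ x′-blade)
                             (+-cancelˡ-≡ N _ _ eq)
  ... | x%≡ , y%≡ = cong₂ (λ u v → fsuc u , fsuc v)
    (toℕ-injective (/-%-injective K (trans x-blade (trans y-blade (sym x′-blade))) x%≡))
    (toℕ-injective (/-%-injective K y-blade y%≡))

  -- All spokes together with the edges of the first blade: pairwise at
  -- distance at most two in the line graph, and exactly one of each colour.
  data Core : V × V → Set where
    spoke  : (y : Fin N) → Core (fzero , fsuc y)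
    blade₀ : ∀ {x y} → toℕ x < toℕ y → toℕ y < K → Core (fsuc x , fsuc y)

  blade₀-same : ∀ {x y : Fin N} → toℕ x < K → toℕ y < K → bladeOf x ≡ bladeOf y
  blade₀-same x<K y<K = trans (m<n⇒m/n≡0 x<K) (sym (m<n⇒m/n≡0 y<K))

  Core⇒WdEdge : ∀ {e} → Core e → WdEdge e
  Core⇒WdEdge (spoke y)        = spoke y
  Core⇒WdEdge (blade₀ x<y y<K) = inBlade x<y (blade₀-same (<-trans x<y y<K) y<K)

  core-meetingEdge : ∀ {e f} → Core e → Core f → ∃ λ g → WdEdge g × Meet g e × Meet g f
  core-meetingEdge (spoke y) (spoke _) =
    _ , spoke y , Meet-refl _ , (fzero , inj₁ refl , inj₁ refl)
  core-meetingEdge (spoke _) (blade₀ {x′} _ _) =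
    _ , spoke x′ , (fzero , inj₁ refl , inj₁ refl) , (fsuc x′ , inj₂ refl , inj₁ refl)
  core-meetingEdge (blade₀ {x} _ _) (spoke _) =
    _ , spoke x , (fsuc x , inj₂ refl , inj₁ refl) , (fzero , inj₁ refl , inj₁ refl)
  core-meetingEdge (blade₀ {x} x<y y<K) (blade₀ {x′} x′<y′ y′<K) with <-cmp (toℕ x) (toℕ x′)
  ... | tri< x<x′ _ _ = _ , inBlade x<x′ (blade₀-same x<K x′<K) ,
                        (fsuc x , inj₁ refl , inj₁ refl) , (fsuc x′ , inj₂ refl , inj₁ refl)
    where x<K = <-trans x<y y<K ; x′<K = <-trans x′<y′ y′<K
  ... | tri> _ _ x′<x = _ , inBlade x′<x (blade₀-same x′<K x<K) ,
                        (fsuc x , inj₂ refl , inj₁ refl) , (fsuc x′ , inj₁ refl , inj₁ refl)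
    where x<K = <-trans x<y y<K ; x′<K = <-trans x′<y′ y′<K
  ... | tri≈ _ x≡x′ _ = _ , Core⇒WdEdge (blade₀ x<y y<K) , Meet-refl _ ,
                        (fsuc x , inj₁ refl , inj₁ (cong fsuc (toℕ-injective x≡x′)))

  core-withColour : ∀ {j} → j < m → ∃ λ e → Core e × colour e ≡ j
  core-withColour {j} j<m with j <? N
  ... | yes j<N = _ , spoke (fromℕ< j<N) , toℕ-fromℕ< j<N
  ... | no  j≮N with pairIndex-surjective K j∸N<tri
    where
    N≤j = ≮⇒≥ j≮N
    j∸N<tri : j ∸ N < triangular K
    j∸N<tri = +-cancelˡ-< N _ _ (subst (_< m) (sym (m+[n∸m]≡n N≤j)) j<m)
  ...   | a , b , a<b , b<K , pair≡ = _ , blade₀ x<y y<K , colour≡j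
    where
    K≤N : K ≤ N
    K≤N = m≤m+n K _
    x y : Fin N
    x = fromℕ< (<-≤-trans (<-trans a<b b<K) K≤N)
    y = fromℕ< (<-≤-trans b<K K≤N)
    x≡a : toℕ x ≡ a
    x≡a = toℕ-fromℕ< _
    y≡b : toℕ y ≡ b
    y≡b = toℕ-fromℕ< _
    x<y : toℕ x < toℕ y
    x<y = subst₂ _<_ (sym x≡a) (sym y≡b) a<b
    y<K : toℕ y < K
    y<K = subst (_< K) (sym y≡b) b<K
    colour≡j : N + pairIndex (toℕ x % K) (toℕ y % K) ≡ j
    colour≡j = begin
      N + pairIndex (toℕ x % K) (toℕ y % K) ≡⟨ cong₂ (λ u v → N + pairIndex u v)
                                                (trans (m<n⇒m%n≡m (<-trans x<y y<K)) x≡a)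
                                                (trans (m<n⇒m%n≡m y<K) y≡b) ⟩
      N + pairIndex a b                     ≡⟨ cong (N +_) pair≡ ⟩
      N + (j ∸ N)                           ≡⟨ m+[n∸m]≡n (≮⇒≥ j≮N) ⟩
      j                                     ∎
      where open ≡-Reasoning

  G : Graph
  G = L W

  edgeAt-WdEdge : ∀ e → WdEdge (edgeAt W e)
  edgeAt-WdEdge e = isEdge⇒WdEdge (edgeAt-isEdge W e)

  colouring : Fin (order G) → Fin m
  colouring e = fromℕ< (colour<m (edgeAt-WdEdge e))

  toℕ-colouring : ∀ e → toℕ (colouring e) ≡ colour (edgeAt W e)
  toℕ-colouring e = toℕ-fromℕ< _

  colouring-injective-on-coherent : ∀ {e f} → Coherent (edgeAt W e) (edgeAt W f) →
                                    colouring e ≡ colouring f → e ≡ f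
  colouring-injective-on-coherent {e} {f} coh eq = edgeAt-injective W
    (colour-injective (edgeAt-WdEdge e) (edgeAt-WdEdge f) coh
      (trans (sym (toℕ-colouring e)) (trans (cong toℕ eq) (toℕ-colouring f))))

  colouring-proper : IsProper G colouring
  colouring-proper e f e∼f =
    let e≢f , e∼f′ = L-adj⁻ W {e} {f} e∼f
    in e≢f ∘ colouring-injective-on-coherent
         (meetingEdge⇒Coherent (edgeAt-WdEdge e) (edgeAt-WdEdge e) (edgeAt-WdEdge f)
           (Meet-refl _) e∼f′)

  colouring-locallyInjective : LocallyInjective G colouring
  colouring-locallyInjective w {e} {f} w∼e w∼f = colouring-injective-on-coherent
    (meetingEdge⇒Coherent (edgeAt-WdEdge w) (edgeAt-WdEdge e) (edgeAt-WdEdge f)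
      (proj₂ (L-adj⁻ W {w} {e} w∼e)) (proj₂ (L-adj⁻ W {w} {f} w∼f)))

  coreEdgeWithColour : ∀ j → ∃ λ i → Core (edgeAt W i) × colour (edgeAt W i) ≡ toℕ j
  coreEdgeWithColour j =
    let e , core , colour≡j = core-withColour (toℕ<n j)
        i , i↦e             = edgeIndex W (WdEdge⇒isEdge (Core⇒WdEdge core))
    in i , subst Core (sym i↦e) core , trans (cong colour i↦e) colour≡j

  coreEdge : Fin m → Fin (order G)
  coreEdge j = proj₁ (coreEdgeWithColour j)

  colouring∘coreEdge≗id : ∀ j → colouring (coreEdge j) ≡ j
  colouring∘coreEdge≗id j =
    toℕ-injective (trans (toℕ-colouring (coreEdge j)) (proj₂ (proj₂ (coreEdgeWithColour j))))

  coreEdge-near : ∀ i j → coreEdge i ≢ coreEdge j → Near G (coreEdge i) (coreEdge j)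
  coreEdge-near i j i≢j =
    let g , g-edge , g∼i , g∼j = core-meetingEdge (proj₁ (proj₂ (coreEdgeWithColour i)))
                                                  (proj₁ (proj₂ (coreEdgeWithColour j)))
    in meetingEdge⇒Near W i≢j (WdEdge⇒isEdge g-edge) g∼i g∼j

  1<m : 1 < m
  1<m = ≤-trans (s≤s (s≤s z≤n)) (≤-trans (m≤m+n K _) (m≤m+n N _))

  χΔ[L[Wd]] : ConditionalChromaticNumber G (maxDeg G) (N + K C 2)
  χΔ[L[Wd]] = subst (ConditionalChromaticNumber G (maxDeg G)) (cong (N +_) (triangular≡C2 K))
    (conditionalChromaticNumber-maxDeg G colouring coreEdge colouring∘coreEdge≗id
       colouring-proper colouring-locallyInjective coreEdge-near 1<m)

proposition3p4 : (k n : ℕ) → 3 ≤ k → 2 ≤ n →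
    ConditionalChromaticNumber (L (Wd k n)) (maxDeg (L (Wd k n))) (n * (k ∸ 1) + (k ∸ 1) C 2)
proposition3p4 (suc (suc (suc k₀))) (suc (suc n₀)) (s≤s (s≤s (s≤s _))) (s≤s (s≤s _)) =
  Windmill.χΔ[L[Wd]] k₀ (suc n₀)
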